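{- Let $A=(1,a_1,\ldots,a_k)$ be an orderly currency. There are no indices $0\leq i<j\leq k$ and $1\leq m\leq k$ satisfying $a_{m-1}\leq a_j-a_i<a_m-a_{m-1}$.
   Context: A currency is a finite sequence of integers $A=(a_0,a_1,\ldots,a_k)$ with $1=a_0<a_1<\cdots<a_k$. For an integer amount $c>0$, $\mathrm{opt}_A(c)$ is the minimum number of coins (values from $A$, repetitions allowed) summing to $c$, and $\mathrm{grd}_A(c)$ is the number of coins used by the greedy algorithm, which repeatedly takes the largest coin not exceeding the remaining amount. $A$ is orderly if $\mathrm{opt}_A(c)=\mathrm{grd}_A(c)$ for all integers $c>0$. -}

module Defs where

open import Data.Nat using (ℕ; zero; suc; _+_; _*_; _∸_; _≤_; _<_; _≤ᵇ_; _⊔_)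
open import Data.Fin using (Fin; toℕ)
open import Data.Bool using (if_then_else_)
open import Data.Product using (Σ; _×_; ∃-syntax)
open import Relation.Binary.PropositionalEquality using (_≡_)

Σᶠ : ∀ {n} → (Fin n → ℕ) → ℕ
Σᶠ {zero}  f = 0
Σᶠ {suc n} f = f Fin.zero + Σᶠ {n} (λ i → f (Fin.suc i))

IsCurrency : ∀ {k} → (Fin (suc k) → ℕ) → Set
IsCurrency a = (a Fin.zero ≡ 1) × (∀ (i j : Fin _) → toℕ i < toℕ j → a i < a j)

value : ∀ {n} → (Fin n → ℕ) → (Fin n → ℕ) → ℕ
value a r = Σᶠ (λ i → r i * a i)

coins : ∀ {n} → (Fin n → ℕ) → ℕ
coins r = Σᶠ r

IsOpt : ∀ {n} → (Fin n → ℕ) → ℕ → ℕ → Set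
IsOpt {n} a c m =
  (∃[ r ] (value a r ≡ c × coins r ≡ m)) ×
  (∀ (r : Fin n → ℕ) → value a r ≡ c → m ≤ coins r)

-- largest coin not exceeding c (0 if none).
largest : ∀ {n} → (Fin n → ℕ) → ℕ → ℕ
largest a c = maxᶠ (λ i → if a i ≤ᵇ c then a i else 0)
  where
  maxᶠ : ∀ {n} → (Fin n → ℕ) → ℕ
  maxᶠ {zero}  f = 0
  maxᶠ {suc n} f = f Fin.zero ⊔ maxᶠ {n} (λ i → f (Fin.suc i))

grdFuel : ∀ {n} → (Fin n → ℕ) → ℕ → ℕ → ℕ
grdFuel a zero    c       = 0
grdFuel a (suc f) zero    = 0
grdFuel a (suc f) (suc c) = suc (grdFuel a f (suc c ∸ largest a (suc c)))

-- Since a_0 = 1, each greedy step decreases the amount by ≥ 1, so fuel c suffices.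
grd : ∀ {n} → (Fin n → ℕ) → ℕ → ℕ
grd a c = grdFuel a c c

Orderly : ∀ {k} → (Fin (suc k) → ℕ) → Set
Orderly a = ∀ c → 0 < c → IsOpt a c (grd a c)

module Submission where

-- Let ℓ = a_{m-1} < n = a_m be consecutive coins of an orderly currency.  We show that no two
-- coins P < P + x differ by an x with ℓ ≤ x and x + ℓ < n; this is the theorem for P = a_i.
--
-- The only consequence of orderliness used is the TWO-COIN LEMMA: if u, v are coins and D is
-- the largest coin ≤ u + v, then u + v − D is 0 or a coin (greedy pays u + v with ≤ 2 coins).
--
-- The argument (sections 5–6) is a descent on P.  Climbing up the coins from the pair
-- P < P + x (x < P) we reach a LEDGE: coins C < C + g with 0 < g < P and no coin in (C + g, C + g + P).  For every
-- coin e with g ≤ e < g + P, C + g is the greedy coin of C + e, so e − g is 0 or a coin.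
--   * If g + ℓ < n, this walks any coin e ∈ (ℓ, P] down to a smaller coin in (ℓ, P]; since P
--     itself is such a coin, this is impossible.
--   * If g + ℓ ≥ n, then x < g, and applying it to e = P and e = P + x gives the smaller pair
--     of coins P − g < (P − g) + x with the same difference x.

open import Defs
open import Data.Nat
open import Data.Nat.Properties
open import Algebra.Properties.CommutativeSemigroup +-commutativeSemigroup using (interchange)
open import Data.Nat.Induction using (<-rec)
open import Data.Bool using (true; false; if_then_else_; T)
open import Data.Unit using (tt)
open import Data.Empty using (⊥)
open import Data.Fin using (Fin; zero; suc; toℕ; inject₁)
open import Data.Fin.Properties using (toℕ-injective; toℕ-inject₁; any?)
open import Data.Product using (_×_; _,_; proj₁; proj₂; ∃-syntax)
open import Data.Sum using (_⊎_; inj₁; inj₂; [_,_]′)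
open import Relation.Binary.PropositionalEquality
open import Relation.Nullary using (¬_; Dec; yes; no; contradiction)
open import Relation.Nullary.Decidable using (_×-dec_)
open import Relation.Binary.Definitions using (tri<; tri≈; tri>)

-- 1. Finite sums and the two-coin representation

Σᶠ-cong : ∀ {n} {f g : Fin n → ℕ} → (∀ i → f i ≡ g i) → Σᶠ f ≡ Σᶠ g
Σᶠ-cong {zero}  f≗g = refl
Σᶠ-cong {suc n} f≗g = cong₂ _+_ (f≗g zero) (Σᶠ-cong (λ i → f≗g (suc i)))

Σᶠ-+ : ∀ {n} (f g : Fin n → ℕ) → Σᶠ (λ i → f i + g i) ≡ Σᶠ f + Σᶠ g
Σᶠ-+ {zero}  f g = refl
Σᶠ-+ {suc n} f g = begin
  (f zero + g zero) + Σᶠ (λ i → f (suc i) + g (suc i))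
    ≡⟨ cong ((f zero + g zero) +_) (Σᶠ-+ (λ i → f (suc i)) (λ i → g (suc i))) ⟩
  (f zero + g zero) + (Σᶠ (λ i → f (suc i)) + Σᶠ (λ i → g (suc i)))
    ≡⟨ interchange (f zero) (g zero) _ _ ⟩
  (f zero + Σᶠ (λ i → f (suc i))) + (g zero + Σᶠ (λ i → g (suc i))) ∎
  where open ≡-Reasoning

≤-Σᶠ : ∀ {n} (f : Fin n → ℕ) i → f i ≤ Σᶠ f
≤-Σᶠ f zero    = m≤m+n (f zero) _
≤-Σᶠ f (suc i) = ≤-trans (≤-Σᶠ (λ j → f (suc j)) i) (m≤n+m _ (f zero))

δ : ∀ {n} → Fin n → Fin n → ℕ
δ zero    zero    = 1
δ zero    (suc i) = 0
δ (suc p) zero    = 0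
δ (suc p) (suc i) = δ p i

Σᶠ-zero : ∀ {n} → Σᶠ {n} (λ _ → 0) ≡ 0
Σᶠ-zero {zero}  = refl
Σᶠ-zero {suc n} = Σᶠ-zero {n}

Σᶠ-δ : ∀ {n} (p : Fin n) (f : Fin n → ℕ) → Σᶠ (λ i → δ p i * f i) ≡ f p
Σᶠ-δ {suc n} zero    f rewrite Σᶠ-zero {n} =
  trans (+-identityʳ (f zero + 0)) (+-identityʳ (f zero))
Σᶠ-δ {suc n} (suc p) f = Σᶠ-δ p (λ i → f (suc i))

pair : ∀ {n} → Fin n → Fin n → Fin n → ℕ
pair p q i = δ p i + δ q i

value-pair : ∀ {n} (a : Fin n → ℕ) p q → value a (pair p q) ≡ a p + a q
value-pair a p q = begin
  Σᶠ (λ i → (δ p i + δ q i) * a i)               ≡⟨ Σᶠ-cong (λ i → *-distribʳ-+ (a i) (δ p i) (δ q i)) ⟩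
  Σᶠ (λ i → δ p i * a i + δ q i * a i)           ≡⟨ Σᶠ-+ (λ i → δ p i * a i) (λ i → δ q i * a i) ⟩
  Σᶠ (λ i → δ p i * a i) + Σᶠ (λ i → δ q i * a i) ≡⟨ cong₂ _+_ (Σᶠ-δ p a) (Σᶠ-δ q a) ⟩
  a p + a q ∎
  where open ≡-Reasoning

coins-pair : ∀ {n} (p q : Fin n) → coins (pair p q) ≡ 2
coins-pair p q = trans (Σᶠ-+ (δ p) (δ q)) (cong₂ _+_ (count p) (count q))
  where
  count : ∀ r → Σᶠ (δ r) ≡ 1
  count r = trans (Σᶠ-cong (λ i → sym (*-identityʳ (δ r i)))) (Σᶠ-δ r (λ _ → 1))

-- 2. The largest coin not exceeding an amount

module _ {n} (a : Fin n → ℕ) where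

  IsCoin : ℕ → Set
  IsCoin v = ∃[ r ] a r ≡ v

  NoCoinBetween : ℕ → ℕ → Set
  NoCoinBetween lo hi = ∀ r → lo < a r → hi ≤ a r

entry-≤ : ∀ v c → (if v ≤ᵇ c then v else 0) ≤ c
entry-≤ v c with v ≤ᵇ c in le
... | true  = ≤ᵇ⇒≤ v c (subst T (sym le) tt)
... | false = z≤n

≤-entry : ∀ v c → v ≤ c → v ≤ (if v ≤ᵇ c then v else 0)
≤-entry v c v≤c with v ≤ᵇ c in le
... | true  = ≤-refl
... | false = contradiction (subst T le (≤⇒≤ᵇ v≤c)) λ ()

entry-cases : ∀ v c → (if v ≤ᵇ c then v else 0) ≡ v ⊎ (if v ≤ᵇ c then v else 0) ≡ 0
entry-cases v c with v ≤ᵇ c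
... | true  = inj₁ refl
... | false = inj₂ refl

largest-≤ : ∀ {n} (a : Fin n → ℕ) c → largest a c ≤ c
largest-≤ {zero}  a c = z≤n
largest-≤ {suc n} a c = ⊔-lub (entry-≤ (a zero) c) (largest-≤ (λ i → a (suc i)) c)

≤-largest : ∀ {n} (a : Fin n → ℕ) c r → a r ≤ c → a r ≤ largest a c
≤-largest a c zero    le = ≤-trans (≤-entry (a zero) c le) (m≤m⊔n _ _)
≤-largest a c (suc r) le = ≤-trans (≤-largest (λ i → a (suc i)) c r le) (m≤n⊔m _ _)

largest-attained : ∀ {n} (a : Fin n → ℕ) c → largest a c ≡ 0 ⊎ IsCoin a (largest a c)
largest-attained {zero}  a c = inj₁ refl
largest-attained {suc n} a c
  with ⊔-sel (if a zero ≤ᵇ c then a zero else 0) (largest (λ i → a (suc i)) c)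
... | inj₁ first with entry-cases (a zero) c
...   | inj₁ coin = inj₂ (zero , sym (trans first coin))
...   | inj₂ none = inj₁ (trans first none)
largest-attained {suc n} a c | inj₂ rest with largest-attained (λ i → a (suc i)) c
...   | inj₁ none       = inj₁ (trans rest none)
...   | inj₂ (r , coin) = inj₂ (suc r , trans coin (sym rest))

largest-≡ : ∀ {n} (a : Fin n → ℕ) d s hi → a d ≤ s → s < hi → NoCoinBetween a (a d) hi →
            largest a s ≡ a d
largest-≡ a d s hi d≤s s<hi clear with largest-attained a s
... | inj₁ L≡0 = trans L≡0 (sym (n≤0⇒n≡0 (subst (a d ≤_) L≡0 (≤-largest a s d d≤s))))
... | inj₂ (r , r≡L) with a d <? a r
...   | yes d<r = contradiction (≤-trans (clear r d<r) (subst (_≤ s) (sym r≡L) (largest-≤ a s)))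
                    (<⇒≱ s<hi)
...   | no  d≮r = trans (sym r≡L)
                    (≤-antisym (≮⇒≥ d≮r) (subst (a d ≤_) (sym r≡L) (≤-largest a s d d≤s)))

-- 3. The greedy algorithm with few coins, for a coin system containing the coin 1

module Greedy {n} (a : Fin (suc n) → ℕ) (a₀≡1 : a zero ≡ 1) where

  -- Since 1 is a coin, every greedy step on a positive amount removes at least 1.
  largest-pos : ∀ c → 0 < c → 0 < largest a c
  largest-pos c c>0 = ≤-trans (≤-reflexive (sym a₀≡1))
                        (≤-largest a c zero (subst (_≤ c) (sym a₀≡1) c>0))

  remainder-≤ : ∀ c → suc c ∸ largest a (suc c) ≤ c
  remainder-≤ c = ∸-monoʳ-≤ (suc c) (largest-pos (suc c) (s≤s z≤n))

  grdFuel-pos : ∀ f c → 0 < c → c ≤ f → 0 < grdFuel a f c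
  grdFuel-pos (suc f) (suc c) _ _ = s≤s z≤n

  grdFuel-one : ∀ f c → 0 < c → c ≤ f → grdFuel a f c ≤ 1 → IsCoin a c
  grdFuel-one (suc f) (suc c) _ c≤f one with suc c ∸ largest a (suc c) in rest
  ... | zero with largest-attained a (suc c)
  ...   | inj₁ L≡0 = contradiction (subst (0 <_) L≡0 (largest-pos (suc c) (s≤s z≤n))) λ ()
  ...   | inj₂ (r , r≡L) = r , trans r≡L (≤-antisym (largest-≤ a (suc c)) (m∸n≡0⇒m≤n rest))
  grdFuel-one (suc f) (suc c) _ c≤f one | suc w =
    contradiction (grdFuel-pos f (suc w) (s≤s z≤n) w≤f) (≤⇒≯ (s≤s⁻¹ one))
    where
    w≤f : suc w ≤ f
    w≤f = ≤-trans (subst (_≤ c) rest (remainder-≤ c)) (s≤s⁻¹ c≤f)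

  greedy-two : ∀ s → 0 < s → grd a s ≤ 2 → s ∸ largest a s ≡ 0 ⊎ IsCoin a (s ∸ largest a s)
  greedy-two (suc s) _ two with suc s ∸ largest a (suc s) in rest
  ... | zero  = inj₁ refl
  ... | suc w =
    inj₂ (grdFuel-one s (suc w) (s≤s z≤n) (subst (_≤ s) rest (remainder-≤ s)) (s≤s⁻¹ two))

-- 4. Currencies and the two-coin lemma

module Currency {k} (a : Fin (suc k) → ℕ) (cur : IsCurrency a) where

  increasing : ∀ i j → toℕ i < toℕ j → a i < a j
  increasing = proj₂ cur

  coin-pos : ∀ r → 0 < a r
  coin-pos zero    = ≤-reflexive (sym (proj₁ cur))
  coin-pos (suc r) = <-trans (coin-pos zero) (increasing zero (suc r) (s≤s z≤n))

  index-< : ∀ r s → a r < a s → toℕ r < toℕ s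
  index-< r s r<s with <-cmp (toℕ r) (toℕ s)
  ... | tri< lt _ _ = lt
  ... | tri≈ _ eq _ = contradiction (cong a (toℕ-injective eq)) (<⇒≢ r<s)
  ... | tri> _ _ gt = contradiction (increasing s r gt) (<⇒≯ r<s)

  next-coin : ∀ (m : Fin k) v → IsCoin a v → a (inject₁ m) < v → a (suc m) ≤ v
  next-coin m v (r , refl) m<r
    with m≤n⇒m<n∨m≡n (subst (_< toℕ r) (toℕ-inject₁ m) (index-< (inject₁ m) r m<r))
  ... | inj₁ sm<r = <⇒≤ (increasing (suc m) r sm<r)
  ... | inj₂ sm≡r = ≤-reflexive (cong a (toℕ-injective sm≡r))

module TwoCoins {k} (a : Fin (suc k) → ℕ) (cur : IsCurrency a) (ord : Orderly a) where
  open Currency a cur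
  open Greedy a (proj₁ cur)

  -- Orderliness bounds greedy on a sum of two coins by the two-coin representation.
  grd-two-coins : ∀ p q → grd a (a p + a q) ≤ 2
  grd-two-coins p q =
    subst (grd a (a p + a q) ≤_) (coins-pair p q)
      (proj₂ (ord (a p + a q) (≤-trans (coin-pos p) (m≤m+n (a p) (a q))))
        (pair p q) (value-pair a p q))

  two-coin-remainder : ∀ {u v D w hi} → IsCoin a u → IsCoin a v → IsCoin a D → u + v ≡ D + w →
                       u + v < hi → NoCoinBetween a D hi → w ≡ 0 ⊎ IsCoin a w
  two-coin-remainder {w = w} {hi} (p , refl) (q , refl) (d , refl) split s<hi clear =
    subst (λ t → t ≡ 0 ⊎ IsCoin a t) rest≡w
      (greedy-two (a p + a q) (≤-trans (coin-pos p) (m≤m+n (a p) (a q))) (grd-two-coins p q))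
    where
    greedy-coin : largest a (a p + a q) ≡ a d
    greedy-coin =
      largest-≡ a d (a p + a q) hi (subst (a d ≤_) (sym split) (m≤m+n (a d) w)) s<hi clear
    rest≡w : a p + a q ∸ largest a (a p + a q) ≡ w
    rest≡w = trans (cong₂ _∸_ split greedy-coin) (m+n∸m≡n (a d) w)

-- 5. Ledges: a gap of width P above a close pair of coins

record Ledge {n} (a : Fin n → ℕ) (P : ℕ) : Set where
  field
    base gap  : ℕ
    base-coin : IsCoin a base
    top-coin  : IsCoin a (base + gap)
    gap>0     : 0 < gap
    gap<P     : gap < P
    clear     : NoCoinBetween a (base + gap) (base + gap + P)

-- Above any pair of coins C < D < C + P there is a ledge of width P: keep stepping to a coin
-- in (D, D + P) until there is none.  The fuel bounds the number of steps by Σᶠ a − D.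
climb : ∀ {n} (a : Fin n → ℕ) {P} f C D → IsCoin a C → IsCoin a D → C < D → D < C + P →
        Σᶠ a ∸ D < f → Ledge a P
climb a {P} (suc f) C D cC cD C<D D<C+P fuel
  with any? (λ r → (D <? a r) ×-dec (a r <? D + P))
... | yes (r , D<r , r<D+P) =
  climb a f D (a r) cD (r , refl) D<r r<D+P
    (<-≤-trans (∸-monoʳ-< D<r (≤-Σᶠ a r)) (s≤s⁻¹ fuel))
... | no none = record
  { base = C ; gap = D ∸ C ; base-coin = cC
  ; top-coin = subst (IsCoin a) (sym C+g≡D) cD
  ; gap>0 = m<n⇒0<n∸m C<D
  ; gap<P = +-cancelˡ-< C (D ∸ C) P (subst (_< C + P) (sym C+g≡D) D<C+P)
  ; clear = λ r above → subst (λ t → t + P ≤ a r) (sym C+g≡D)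
              (≮⇒≥ (λ below → none (r , subst (_< a r) C+g≡D above , below)))
  }
  where
  C+g≡D : C + (D ∸ C) ≡ D
  C+g≡D = m+[n∸m]≡n (<⇒≤ C<D)

ledge-above : ∀ {n} (a : Fin n → ℕ) {P C D} → IsCoin a C → IsCoin a D → C < D → D < C + P →
              Ledge a P
ledge-above a {C = C} {D} cC cD C<D D<C+P = climb a (suc (Σᶠ a ∸ D)) C D cC cD C<D D<C+P ≤-refl

-- 6. The descent

module Descent {k} (a : Fin (suc k) → ℕ) (cur : IsCurrency a) (ord : Orderly a) where
  open Currency a cur
  open TwoCoins a cur ord

  -- On a ledge of width P, C + gap is the greedy coin of C + e for every coin e with
  -- gap ≤ e < gap + P, so e − gap is 0 or a coin.
  ledge-step : ∀ {P} (L : Ledge a P) → let open Ledge L in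
               ∀ e → IsCoin a e → gap ≤ e → e < gap + P → e ∸ gap ≡ 0 ⊎ IsCoin a (e ∸ gap)
  ledge-step {P} L e ce g≤e e<g+P =
    two-coin-remainder base-coin ce top-coin split bound clear
    where
    open Ledge L
    open ≡-Reasoning
    split : base + e ≡ (base + gap) + (e ∸ gap)
    split = begin
      base + e                  ≡⟨ cong (base +_) (sym (m+[n∸m]≡n g≤e)) ⟩
      base + (gap + (e ∸ gap))  ≡⟨ sym (+-assoc base gap (e ∸ gap)) ⟩
      (base + gap) + (e ∸ gap)  ∎
    bound : base + e < base + gap + P
    bound = subst (base + e <_) (sym (+-assoc base gap P)) (+-monoʳ-< base e<g+P)

  ledge-shift : ∀ {P} (L : Ledge a P) → let open Ledge L in
                ∀ x → IsCoin a P → IsCoin a (P + x) → 0 < x → x < gap →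
                IsCoin a (P ∸ gap) × IsCoin a (P ∸ gap + x)
  ledge-shift {P} L x cP cPx x>0 x<g = lower , lower+x
    where
    open Ledge L
    g≤P : gap ≤ P
    g≤P = <⇒≤ gap<P
    lower : IsCoin a (P ∸ gap)
    lower = [ (λ E≡0 → contradiction E≡0 (≢-sym (<⇒≢ (m<n⇒0<n∸m gap<P)))) , (λ cE → cE) ]′
              (ledge-step L P cP g≤P (m<n+m P gap>0))
    lower+x : IsCoin a (P ∸ gap + x)
    lower+x = [ (λ E+x≡0 → contradiction (trans (sym (+-∸-comm x g≤P)) E+x≡0)
                             (≢-sym (<⇒≢ (≤-trans x>0 (m≤n+m x (P ∸ gap))))))
              , subst (IsCoin a) (+-∸-comm x g≤P) ]′
                (ledge-step L (P + x) cPx (≤-trans g≤P (m≤m+n P x))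
                  (subst (P + x <_) (+-comm P gap) (+-monoʳ-< P x<g)))

  module _ (m : Fin k) where
    ℓ n : ℕ
    ℓ = a (inject₁ m)
    n = a (suc m)

    -- A ledge whose gap is shorter than n − ℓ leaves no coin in (ℓ, P]: subtracting the gap
    -- from such a coin stays above ℓ, giving a smaller one.
    window-empty : ∀ {P} (L : Ledge a P) → Ledge.gap L + ℓ < n →
                   ∀ e → IsCoin a e → ℓ < e → e ≤ P → ⊥
    window-empty {P} L short = <-rec Window step
      where
      open Ledge L
      Window : ℕ → Set
      Window e = IsCoin a e → ℓ < e → e ≤ P → ⊥
      step : ∀ e → (∀ {e′} → e′ < e → Window e′) → Window e
      step e smaller ce ℓ<e e≤P =
        [ (λ e′≡0 → contradiction (subst (ℓ <_) e′≡0 ℓ<e′) λ ())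
        , (λ ce′ → smaller e′<e ce′ ℓ<e′ (≤-trans (m∸n≤m e gap) e≤P))
        ]′ (ledge-step L e ce g≤e (≤-<-trans e≤P (m<n+m P gap>0)))
        where
        g+ℓ<e : gap + ℓ < e
        g+ℓ<e = <-≤-trans short (next-coin m e ce ℓ<e)
        g≤e : gap ≤ e
        g≤e = ≤-trans (m≤m+n gap ℓ) (<⇒≤ g+ℓ<e)
        ℓ<e′ : ℓ < e ∸ gap
        ℓ<e′ = +-cancelˡ-< gap ℓ (e ∸ gap) (subst (gap + ℓ <_) (sym (m+[n∸m]≡n g≤e)) g+ℓ<e)
        e′<e : e ∸ gap < e
        e′<e = ∸-monoʳ-< gap>0 g≤e

    no-shifted-pair : ∀ P → IsCoin a P → ∀ x → IsCoin a (P + x) → ℓ ≤ x → x + ℓ < n → ⊥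
    no-shifted-pair = <-rec Shifted step
      where
      Shifted : ℕ → Set
      Shifted P = IsCoin a P → ∀ x → IsCoin a (P + x) → ℓ ≤ x → x + ℓ < n → ⊥
      step : ∀ P → (∀ {P′} → P′ < P → Shifted P′) → Shifted P
      step P smaller cP x cPx ℓ≤x short = by-gap (gap + ℓ <? n)
        where
        x>0 : 0 < x
        x>0 = ≤-trans (coin-pos (inject₁ m)) ℓ≤x
        P>0 : 0 < P
        P>0 = subst (0 <_) (proj₂ cP) (coin-pos (proj₁ cP))
        n≤P+x : n ≤ P + x
        n≤P+x = next-coin m (P + x) cPx (<-≤-trans (s≤s ℓ≤x) (+-monoˡ-≤ x P>0))
        ℓ<P : ℓ < P
        ℓ<P = ≰⇒> (λ P≤ℓ → <⇒≱ (≤-<-trans (subst (P + x ≤_) (+-comm ℓ x) (+-monoˡ-≤ x P≤ℓ)) short)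
                                 n≤P+x)
        x<P : x < P
        x<P = <-≤-trans (≤-<-trans (m≤m+n x ℓ) short) (next-coin m P cP ℓ<P)
        L : Ledge a P
        L = ledge-above a cP cPx (m<m+n P x>0) (+-monoʳ-< P x<P)
        open Ledge L using (gap; gap>0; gap<P)
        -- A short gap empties the window (ℓ, P], which contains P; a long one exceeds x,
        -- so the pair shifts down to P − gap.
        by-gap : Dec (gap + ℓ < n) → ⊥
        by-gap (yes short-gap) = window-empty L short-gap P cP ℓ<P ≤-refl
        by-gap (no long-gap)   =
          smaller (∸-monoʳ-< gap>0 (<⇒≤ gap<P)) (proj₁ lower) x (proj₂ lower) ℓ≤x short
          where
          x<gap : x < gap
          x<gap = +-cancelʳ-< ℓ x gap (<-≤-trans short (≮⇒≥ long-gap))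
          lower : IsCoin a (P ∸ gap) × IsCoin a (P ∸ gap + x)
          lower = ledge-shift L x cP cPx x>0 x<gap

lemma5p2 : ∀ (k : ℕ) (a : Fin (suc k) → ℕ) → IsCurrency a → Orderly a →
    ¬ (∃[ i ] ∃[ j ] ∃[ m ] (toℕ i < toℕ j ×
        (a (inject₁ m) ≤ a j ∸ a i) × (a j ∸ a i < a (Fin.suc m) ∸ a (inject₁ m))))
lemma5p2 k a cur ord (i , j , m , i<j , ℓ≤x , x<n∸ℓ) =
  no-shifted-pair m (a i) (i , refl) (a j ∸ a i) (j , sym aᵢ+x≡aⱼ) ℓ≤x x+ℓ<n
  where
  open Currency a cur
  open Descent a cur ord
  aᵢ+x≡aⱼ : a i + (a j ∸ a i) ≡ a j
  aᵢ+x≡aⱼ = m+[n∸m]≡n (<⇒≤ (increasing i j i<j))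
  ℓ<n : a (inject₁ m) < a (suc m)
  ℓ<n = increasing (inject₁ m) (suc m) (≤-reflexive (cong suc (toℕ-inject₁ m)))
  x+ℓ<n : (a j ∸ a i) + a (inject₁ m) < a (suc m)
  x+ℓ<n = subst ((a j ∸ a i) + a (inject₁ m) <_) (m∸n+n≡m (<⇒≤ ℓ<n))
            (+-monoˡ-< (a (inject₁ m)) x<n∸ℓ)
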